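{- Let $k=3$ and let $A_n,\bar A_n$ ($n\ge1$) be the antiregular $3$-hypergraphs defined in the context. Then for every $n\ge 1$ the independence polynomials $I(A_n;x)$ and $I(\bar A_n;x)$ are log-concave.
   Context: All hypergraphs are $3$-uniform. For a binary string $b=b_1\cdots b_n$, let $H(b)$ be the $3$-uniform hypergraph on $\{1,\dots,n\}$ in which a $3$-subset is a hyperedge iff its largest element $j$ satisfies $b_j=1$. For $n\le 2$, $A_n=\bar A_n$ is the edgeless hypergraph on $n$ vertices; for $n\ge 3$, $A_n=H(b)$ with $b$ of length $n$, $b_1=b_2=0$, $b_3,\dots,b_n$ alternating and $b_n=1$, and $\bar A_n$ is the same with $b_n=0$. A vertex set is independent if it contains no hyperedge, and $I(H;x)=\sum_{W\text{ independent}}x^{|W|}$. A polynomial $\sum_{i=0}^m a_ix^i$ of degree $m$ is log-concave if $a_i^2\ge a_{i-1}a_{i+1}$ for all $1\le i\le m-1$. -}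

module Defs where

open import Data.Bool using (Bool; true; false; _∧_; _∨_; not; if_then_else_; _xor_)
open import Data.Nat using (ℕ; zero; suc; _+_; _*_; _∸_; _≤_; _<ᵇ_; _≡ᵇ_; _⊔_)
open import Data.Nat.Properties using ()
open import Data.Fin using (Fin; zero; suc; toℕ)
open import Data.Vec using (Vec; []; _∷_)
open import Data.List using (List; []; _∷_; map; _++_; filter; length; foldr)
open import Data.Maybe using (Maybe; just; nothing)
open import Relation.Nullary.Decidable using (does)
open import Relation.Binary.PropositionalEquality using (_≡_; subst; sym)
open import Data.Bool using (T; T?)
open import Data.Unit using (tt)
open import Data.Nat.Properties using (≡ᵇ⇒≡)
open import Data.Bool.Properties using ()
open import Relation.Nullary using (Dec; yes; no)

-- Subsets of the vertex set Fin n ({1..n} shifted to {0..n-1}) as characteristic vectors.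
Subset : ℕ → Set
Subset n = Vec Bool n

allSubsets : (n : ℕ) → List (Subset n)
allSubsets zero = [] ∷ []
allSubsets (suc n) = map (false ∷_) (allSubsets n) ++ map (true ∷_) (allSubsets n)

card : {n : ℕ} → Subset n → ℕ
card [] = 0
card (true ∷ s) = suc (card s)
card (false ∷ s) = card s

_⊆ᵇ_ : {n : ℕ} → Subset n → Subset n → Bool
[] ⊆ᵇ [] = true
(x ∷ s) ⊆ᵇ (y ∷ t) = (not x ∨ y) ∧ (s ⊆ᵇ t)

maxElt : {n : ℕ} → Subset n → Maybe (Fin n)
maxElt [] = nothing
maxElt (x ∷ s) with maxElt s
... | just k = just (suc k)
... | nothing = if x then just zero else nothing

record Hypergraph3 (n : ℕ) : Set where
  field
    isEdge   : Subset n → Bool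
    uniform  : (S : Subset n) → isEdge S ≡ true → card S ≡ 3
open Hypergraph3 public

atMax : {n : ℕ} → (Fin n → Bool) → Maybe (Fin n) → Bool
atMax b (just k) = b k
atMax b nothing  = false

Hᵇ-edge : {n : ℕ} → (Fin n → Bool) → Subset n → Bool
Hᵇ-edge b S = (card S ≡ᵇ 3) ∧ atMax b (maxElt S)

Hᵇ-uniform : {n : ℕ} (b : Fin n → Bool) (S : Subset n) → Hᵇ-edge b S ≡ true → card S ≡ 3
Hᵇ-uniform b S eq with card S ≡ᵇ 3 in e
... | true  = ≡ᵇ⇒≡ (card S) 3 (subst T (sym e) tt)
... | false with () ← eq

H : {n : ℕ} → (Fin n → Bool) → Hypergraph3 n
H b = record { isEdge = Hᵇ-edge b ; uniform = Hᵇ-uniform b }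

-- Antiregular bit strings (0-indexed: vertex i is the paper's vertex i+1).
-- b_1 = b_2 = 0; for 3 ≤ j ≤ n, b_j alternates, with b_n = 1 (for A_n) or b_n = 0 (for Ā_n),
-- i.e. b_j = 1 iff (n - j) is even (A_n), resp. odd (Ā_n).
even? : ℕ → Bool
even? zero = true
even? (suc m) = not (even? m)

antiBits : (last : Bool) → (n : ℕ) → Fin n → Bool
antiBits last n i = if toℕ i <ᵇ 2 then false else (if even? (n ∸ suc (toℕ i)) then last else not last)

A : (n : ℕ) → Hypergraph3 n
A n = H (antiBits true n)

Ā : (n : ℕ) → Hypergraph3 n
Ā n = H (antiBits false n)

allB : {X : Set} → (X → Bool) → List X → Bool
allB p [] = true
allB p (x ∷ xs) = p x ∧ allB p xs

independent : {n : ℕ} → Hypergraph3 n → Subset n → Bool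
independent G W = allB (λ S → not ((S ⊆ᵇ W) ∧ isEdge G S)) (allSubsets _)

indepCoeff : {n : ℕ} → Hypergraph3 n → ℕ → ℕ
indepCoeff G i = length (filter (λ W → T? (independent G W ∧ (card W ≡ᵇ i))) (allSubsets _))

indepDegree : {n : ℕ} → Hypergraph3 n → ℕ
indepDegree G = foldr (λ W m → (if independent G W then card W else 0) ⊔ m) 0 (allSubsets _)

LogConcave : (a : ℕ → ℕ) (m : ℕ) → Set
LogConcave a m = (i : ℕ) → 1 ≤ i → i + 1 ≤ m → a (i ∸ 1) * a (i + 1) ≤ a i * a i

IndepLogConcave : {n : ℕ} → Hypergraph3 n → Set
IndepLogConcave G = LogConcave (indepCoeff G) (indepDegree G)

-- A set W is independent in H(b) iff every vertex of W with at least two smaller vertices in W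
-- has bit 0.  Counting such sets vertex by vertex, appending a vertex with bit 0 multiplies the
-- independence polynomial by 1 + X, and appending a vertex with bit 1 to a string of length n
-- adds X + nX².  The strings of A_{n+1} and Ā_{n+1} extend those of Ā_n and A_n, so
-- I(Ā_{n+1}) = (1 + X) I(A_n) and I(A_{n+1}) = I(Ā_n) + X + nX².  Multiplication by 1 + X
-- preserves log-concavity of coefficient sequences without internal zeros.  The second
-- recurrence changes only the coefficients of X and X²; the two new inequalities follow from
-- closed forms, depending on the parity of n, for the coefficients of X³ and X⁴ in I(Ā_n).
module Submission where

open import Defs
open import Data.Bool using (Bool; true; false; _∧_; not; if_then_else_; T?)
open import Data.Bool.Properties using (∧-identityʳ; ∧-zeroʳ)
open import Data.Fin using (Fin; zero; suc; toℕ)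
open import Data.List using (List; []; _∷_; map; _++_; filter; length)
open import Data.Maybe using (Maybe; just; nothing)
open import Data.Nat using (ℕ; zero; suc; _+_; _*_; _∸_; _≤_; _≥_; _≡ᵇ_; z≤n; s≤s; NonZero)
open import Data.Nat.Properties
open import Algebra.Properties.CommutativeSemigroup +-commutativeSemigroup using () renaming (interchange to +-interchange)
open import Data.Nat.Tactic.RingSolver using (solve-∀)
open import Data.Product using (Σ; _×_; _,_; proj₁)
open import Data.Sum using (_⊎_; inj₁; inj₂)
open import Data.Vec using (Vec; []; _∷_; tabulate; _∷ʳ_)
open import Function using (_∘_)
open import Relation.Binary.PropositionalEquality

allB-++ : {X : Set} (p : X → Bool) (xs ys : List X) → allB p (xs ++ ys) ≡ (allB p xs ∧ allB p ys)
allB-++ p [] ys = refl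
allB-++ p (x ∷ xs) ys with p x
... | true = allB-++ p xs ys
... | false = refl

allB-map : {X Y : Set} (p : Y → Bool) (f : X → Y) (xs : List X) → allB p (map f xs) ≡ allB (p ∘ f) xs
allB-map p f [] = refl
allB-map p f (x ∷ xs) = cong (p (f x) ∧_) (allB-map p f xs)

allB-cong : {X : Set} {p q : X → Bool} → (∀ x → p x ≡ q x) → (xs : List X) → allB p xs ≡ allB q xs
allB-cong e [] = refl
allB-cong e (x ∷ xs) = cong₂ _∧_ (e x) (allB-cong e xs)

allB-true : {X : Set} (xs : List X) → allB (λ _ → true) xs ≡ true
allB-true [] = refl
allB-true (x ∷ xs) = allB-true xs

allB-allSubsets-suc : {n : ℕ} (p : Subset (suc n) → Bool) →
  allB p (allSubsets (suc n)) ≡ (allB (p ∘ (false ∷_)) (allSubsets n) ∧ allB (p ∘ (true ∷_)) (allSubsets n))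
allB-allSubsets-suc {n} p =
  trans (allB-++ p (map (false ∷_) (allSubsets n)) (map (true ∷_) (allSubsets n)))
        (cong₂ _∧_ (allB-map p (false ∷_) (allSubsets n)) (allB-map p (true ∷_) (allSubsets n)))

-- When k vertices of a hyperedge
-- are still missing and the largest vertex chosen so far carries the bit e, a set S of later
-- vertices completes it iff |S| = k and the bit at the overall maximum is 1.
atMaxOr : {n : ℕ} → (Fin n → Bool) → Bool → Maybe (Fin n) → Bool
atMaxOr b e (just k) = b k
atMaxOr b e nothing  = e

completesEdge : ℕ → Bool → {n : ℕ} → (Fin n → Bool) → Subset n → Bool
completesEdge k e b S = (card S ≡ᵇ k) ∧ atMaxOr b e (maxElt S)

avoidsCompletion : ℕ → Bool → {n : ℕ} → (Fin n → Bool) → Subset n → Subset n → Bool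
avoidsCompletion k e b W S = not ((S ⊆ᵇ W) ∧ completesEdge k e b S)

noCompletionIn : ℕ → Bool → {n : ℕ} → (Fin n → Bool) → Subset n → Bool
noCompletionIn k e b []                = not ((0 ≡ᵇ k) ∧ e)
noCompletionIn k e b (false ∷ W)       = noCompletionIn k e (b ∘ suc) W
noCompletionIn zero e b (true ∷ W)    = noCompletionIn zero e (b ∘ suc) W
noCompletionIn (suc k) e b (true ∷ W) = noCompletionIn (suc k) e (b ∘ suc) W ∧ noCompletionIn k (b zero) (b ∘ suc) W

atMaxOr-false∷ : {n : ℕ} (b : Fin (suc n) → Bool) (e : Bool) (S : Subset n) →
                 atMaxOr b e (maxElt (false ∷ S)) ≡ atMaxOr (b ∘ suc) e (maxElt S)
atMaxOr-false∷ b e S with maxElt S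
... | just k  = refl
... | nothing = refl

atMaxOr-true∷ : {n : ℕ} (b : Fin (suc n) → Bool) (e : Bool) (S : Subset n) →
                atMaxOr b e (maxElt (true ∷ S)) ≡ atMaxOr (b ∘ suc) (b zero) (maxElt S)
atMaxOr-true∷ b e S with maxElt S
... | just k  = refl
... | nothing = refl

avoidsCompletion-false∷ : (k : ℕ) (e : Bool) {n : ℕ} (b : Fin (suc n) → Bool) (y : Bool) (W S : Subset n) →
                          avoidsCompletion k e b (y ∷ W) (false ∷ S) ≡ avoidsCompletion k e (b ∘ suc) W S
avoidsCompletion-false∷ k e b y W S = cong (λ z → not ((S ⊆ᵇ W) ∧ ((card S ≡ᵇ k) ∧ z))) (atMaxOr-false∷ b e S)

avoidsCompletion-true∷ : (k : ℕ) (e : Bool) {n : ℕ} (b : Fin (suc n) → Bool) (W S : Subset n) →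
                         avoidsCompletion (suc k) e b (true ∷ W) (true ∷ S) ≡ avoidsCompletion k (b zero) (b ∘ suc) W S
avoidsCompletion-true∷ k e b W S = cong (λ z → not ((S ⊆ᵇ W) ∧ ((card S ≡ᵇ k) ∧ z))) (atMaxOr-true∷ b e S)

allB-avoidsCompletion : (k : ℕ) (e : Bool) {n : ℕ} (b : Fin n → Bool) (W : Subset n) →
                        allB (avoidsCompletion k e b W) (allSubsets n) ≡ noCompletionIn k e b W
allB-avoidsCompletion k e b [] = ∧-identityʳ _
allB-avoidsCompletion k e {suc n} b (y ∷ W) =
  trans (allB-allSubsets-suc (avoidsCompletion k e b (y ∷ W)))
        (trans (cong₂ _∧_ headAbsent (headPresent y k)) (combine y k))
  where
  headAbsent : allB (avoidsCompletion k e b (y ∷ W) ∘ (false ∷_)) (allSubsets n) ≡ noCompletionIn k e (b ∘ suc) W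
  headAbsent = trans (allB-cong (avoidsCompletion-false∷ k e b y W) (allSubsets n)) (allB-avoidsCompletion k e (b ∘ suc) W)
  headCondition : Bool → ℕ → Bool
  headCondition true (suc k) = noCompletionIn k (b zero) (b ∘ suc) W
  headCondition y k = true
  headPresent : (y : Bool) (k : ℕ) →
                allB (avoidsCompletion k e b (y ∷ W) ∘ (true ∷_)) (allSubsets n) ≡ headCondition y k
  headPresent false k = allB-true (allSubsets n)
  headPresent true zero = trans (allB-cong (λ S → cong not (∧-zeroʳ (S ⊆ᵇ W))) (allSubsets n)) (allB-true (allSubsets n))
  headPresent true (suc k) =
    trans (allB-cong (avoidsCompletion-true∷ k e b W) (allSubsets n)) (allB-avoidsCompletion k (b zero) (b ∘ suc) W)
  combine : (y : Bool) (k : ℕ) → (noCompletionIn k e (b ∘ suc) W ∧ headCondition y k) ≡ noCompletionIn k e b (y ∷ W)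
  combine false k = ∧-identityʳ _
  combine true zero = ∧-identityʳ _
  combine true (suc k) = refl

-- admissible r v W: every vertex of W preceded by at least r vertices of W has bit false in v.
admissible : ℕ → {n : ℕ} → Vec Bool n → Subset n → Bool
admissible r [] [] = true
admissible r (x ∷ v) (false ∷ W) = admissible r v W
admissible (suc r) (x ∷ v) (true ∷ W) = admissible r v W
admissible zero (x ∷ v) (true ∷ W) = admissible zero v W ∧ not x

admissible-suc : (r : ℕ) {n : ℕ} (v : Vec Bool n) (W : Subset n) → admissible r v W ≡ true → admissible (suc r) v W ≡ true
admissible-suc r [] [] _ = refl
admissible-suc r (x ∷ v) (false ∷ W) h = admissible-suc r v W h
admissible-suc (suc r) (x ∷ v) (true ∷ W) h = admissible-suc r v W h
admissible-suc zero (x ∷ v) (true ∷ W) h with admissible zero v W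
... | true = refl

noCompletionIn-zero : (e : Bool) {n : ℕ} (b : Fin n → Bool) (W : Subset n) → noCompletionIn zero e b W ≡ not e
noCompletionIn-zero e b [] = refl
noCompletionIn-zero e b (false ∷ W) = noCompletionIn-zero e (b ∘ suc) W
noCompletionIn-zero e b (true ∷ W) = noCompletionIn-zero e (b ∘ suc) W

∧-absorbs-implied : (a b : Bool) → (b ≡ true → a ≡ true) → (a ∧ b) ≡ b
∧-absorbs-implied a false _ = ∧-zeroʳ a
∧-absorbs-implied a true h = trans (∧-identityʳ a) (h refl)

noCompletionIn-suc : (k : ℕ) (e : Bool) {n : ℕ} (b : Fin n → Bool) (W : Subset n) →
                     noCompletionIn (suc k) e b W ≡ admissible k (tabulate b) W
noCompletionIn-suc k e b [] = refl
noCompletionIn-suc k e b (false ∷ W) = noCompletionIn-suc k e (b ∘ suc) W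
noCompletionIn-suc zero e b (true ∷ W) =
  cong₂ _∧_ (noCompletionIn-suc zero e (b ∘ suc) W) (noCompletionIn-zero (b zero) (b ∘ suc) W)
noCompletionIn-suc (suc k) e b (true ∷ W) =
  trans (cong₂ _∧_ (noCompletionIn-suc (suc k) e (b ∘ suc) W) (noCompletionIn-suc k (b zero) (b ∘ suc) W))
        (∧-absorbs-implied _ _ (admissible-suc k (tabulate (b ∘ suc)) W))

independent-H : {n : ℕ} (b : Fin n → Bool) (W : Subset n) → independent (H b) W ≡ admissible 2 (tabulate b) W
independent-H {n} b W =
  trans (allB-cong (λ S → cong (λ z → not ((S ⊆ᵇ W) ∧ ((card S ≡ᵇ 3) ∧ z))) (atMax≡atMaxOr (maxElt S))) (allSubsets n))
        (trans (allB-avoidsCompletion 3 false b W) (noCompletionIn-suc 2 false b W))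
  where
  atMax≡atMaxOr : (m : Maybe (Fin n)) → atMax b m ≡ atMaxOr b false m
  atMax≡atMaxOr (just k) = refl
  atMax≡atMaxOr nothing = refl

countᵇ : {X : Set} → (X → Bool) → List X → ℕ
countᵇ p [] = 0
countᵇ p (x ∷ xs) = if p x then suc (countᵇ p xs) else countᵇ p xs

length-filter≡countᵇ : {X : Set} (p : X → Bool) (xs : List X) → length (filter (λ x → T? (p x)) xs) ≡ countᵇ p xs
length-filter≡countᵇ p [] = refl
length-filter≡countᵇ p (x ∷ xs) with p x
... | true  = cong suc (length-filter≡countᵇ p xs)
... | false = length-filter≡countᵇ p xs

countᵇ-++ : {X : Set} (p : X → Bool) (xs ys : List X) → countᵇ p (xs ++ ys) ≡ countᵇ p xs + countᵇ p ys
countᵇ-++ p [] ys = refl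
countᵇ-++ p (x ∷ xs) ys with p x
... | true  = cong suc (countᵇ-++ p xs ys)
... | false = countᵇ-++ p xs ys

countᵇ-map : {X Y : Set} (p : Y → Bool) (f : X → Y) (xs : List X) → countᵇ p (map f xs) ≡ countᵇ (p ∘ f) xs
countᵇ-map p f [] = refl
countᵇ-map p f (x ∷ xs) with p (f x)
... | true  = cong suc (countᵇ-map p f xs)
... | false = countᵇ-map p f xs

countᵇ-cong : {X : Set} {p q : X → Bool} → (∀ x → p x ≡ q x) → (xs : List X) → countᵇ p xs ≡ countᵇ q xs
countᵇ-cong e [] = refl
countᵇ-cong {q = q} e (x ∷ xs) rewrite e x with q x
... | true  = cong suc (countᵇ-cong e xs)
... | false = countᵇ-cong e xs

countᵇ-false : {X : Set} (xs : List X) → countᵇ (λ _ → false) xs ≡ 0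
countᵇ-false [] = refl
countᵇ-false (x ∷ xs) = countᵇ-false xs

countᵇ-allSubsets-suc : {n : ℕ} (p : Subset (suc n) → Bool) →
  countᵇ p (allSubsets (suc n)) ≡ countᵇ (p ∘ (false ∷_)) (allSubsets n) + countᵇ (p ∘ (true ∷_)) (allSubsets n)
countᵇ-allSubsets-suc {n} p =
  trans (countᵇ-++ p (map (false ∷_) (allSubsets n)) (map (true ∷_) (allSubsets n)))
        (cong₂ _+_ (countᵇ-map p (false ∷_) (allSubsets n)) (countᵇ-map p (true ∷_) (allSubsets n)))

admissibleCount : ℕ → {n : ℕ} → Vec Bool n → ℕ → ℕ
admissibleWithHead : ℕ → Bool → {n : ℕ} → Vec Bool n → ℕ → ℕ

admissibleCount r [] zero = 1
admissibleCount r [] (suc i) = 0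
admissibleCount r (x ∷ v) zero = admissibleCount r v zero
admissibleCount r (x ∷ v) (suc i) = admissibleCount r v (suc i) + admissibleWithHead r x v i

admissibleWithHead (suc r) x v i = admissibleCount r v i
admissibleWithHead zero false v i = admissibleCount zero v i
admissibleWithHead zero true v i = 0

admissibleOfSize : ℕ → {n : ℕ} → Vec Bool n → ℕ → Subset n → Bool
admissibleOfSize r v i W = admissible r v W ∧ (card W ≡ᵇ i)

countᵇ-admissible : (r : ℕ) {n : ℕ} (v : Vec Bool n) (i : ℕ) →
                    countᵇ (admissibleOfSize r v i) (allSubsets n) ≡ admissibleCount r v i
countᵇ-admissible r [] zero = refl
countᵇ-admissible r [] (suc i) = refl
countᵇ-admissible r {suc n} (x ∷ v) zero =
  trans (countᵇ-allSubsets-suc (admissibleOfSize r (x ∷ v) zero))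
        (trans (cong₂ _+_ (countᵇ-admissible r v zero)
                          (trans (countᵇ-cong (λ W → ∧-zeroʳ _) (allSubsets n)) (countᵇ-false (allSubsets n))))
               (+-identityʳ _))
countᵇ-admissible r {suc n} (x ∷ v) (suc i) =
  trans (countᵇ-allSubsets-suc (admissibleOfSize r (x ∷ v) (suc i)))
        (cong₂ _+_ (countᵇ-admissible r v (suc i)) (withHead r x))
  where
  withHead : (r : ℕ) (x : Bool) →
             countᵇ (admissibleOfSize r (x ∷ v) (suc i) ∘ (true ∷_)) (allSubsets n) ≡ admissibleWithHead r x v i
  withHead (suc r) x = countᵇ-admissible r v i
  withHead zero false =
    trans (countᵇ-cong (λ W → cong (_∧ (card W ≡ᵇ i)) (∧-identityʳ _)) (allSubsets n)) (countᵇ-admissible zero v i)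
  withHead zero true =
    trans (countᵇ-cong (λ W → cong (_∧ (card W ≡ᵇ i)) (∧-zeroʳ _)) (allSubsets n)) (countᵇ-false (allSubsets n))

indepCoeff-H : {n : ℕ} (b : Fin n → Bool) (i : ℕ) → indepCoeff (H b) i ≡ admissibleCount 2 (tabulate b) i
indepCoeff-H {n} b i =
  trans (length-filter≡countᵇ _ (allSubsets n))
        (trans (countᵇ-cong (λ W → cong (_∧ (card W ≡ᵇ i)) (independent-H b W)) (allSubsets n))
               (countᵇ-admissible 2 (tabulate b) i))

-- Coefficient sequences of polynomials: f ⊕ g is the sum and shift f the product X · f.
infixl 6 _⊕_

_⊕_ : (ℕ → ℕ) → (ℕ → ℕ) → ℕ → ℕ
(f ⊕ g) i = f i + g i

shift : (ℕ → ℕ) → ℕ → ℕ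
shift f zero = 0
shift f (suc i) = f i

shift-zero : (i : ℕ) → shift (λ _ → 0) i ≡ 0
shift-zero zero = refl
shift-zero (suc i) = refl

admissibleCount-0 : (r : ℕ) {n : ℕ} (v : Vec Bool n) → admissibleCount r v 0 ≡ 1
admissibleCount-0 r [] = refl
admissibleCount-0 r (x ∷ v) = admissibleCount-0 r v

admissibleCount-∷ : (r : ℕ) (x : Bool) {n : ℕ} (v : Vec Bool n) →
                    admissibleCount r (x ∷ v) ≗ admissibleCount r v ⊕ shift (admissibleWithHead r x v)
admissibleCount-∷ r x v zero = sym (+-identityʳ _)
admissibleCount-∷ r x v (suc i) = refl

choose2 : ℕ → ℕ
choose2 zero = 0
choose2 (suc n) = choose2 n + n

choose2≤square : (n : ℕ) → choose2 n ≤ n * n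
choose2≤square zero = z≤n
choose2≤square (suc n) = begin
  choose2 n + n         ≤⟨ +-monoˡ-≤ n (choose2≤square n) ⟩
  n * n + n             ≤⟨ m≤m+n (n * n + n) (suc n) ⟩
  n * n + n + suc n     ≡⟨ expand n ⟩
  suc n * suc n         ∎
  where
  open ≤-Reasoning
  expand : (n : ℕ) → n * n + n + suc n ≡ suc n * suc n
  expand = solve-∀

admissibleCount-1 : (r : ℕ) {n : ℕ} (v : Vec Bool n) → admissibleCount (suc r) v 1 ≡ n
admissibleCount-1 r [] = refl
admissibleCount-1 r {suc n} (x ∷ v) =
  trans (cong₂ _+_ (admissibleCount-1 r v) (admissibleCount-0 r v)) (+-comm n 1)

admissibleCount-2 : (r : ℕ) {n : ℕ} (v : Vec Bool n) → admissibleCount (2 + r) v 2 ≡ choose2 n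
admissibleCount-2 r [] = refl
admissibleCount-2 r (x ∷ v) = cong₂ _+_ (admissibleCount-2 r v) (admissibleCount-1 r v)

-- binomBelow r n j is the number of j-subsets of an n-set when j < r, and 0 otherwise.
binomBelow : ℕ → ℕ → ℕ → ℕ
binomBelow zero n j = 0
binomBelow (suc r) n zero = 1
binomBelow (suc r) zero (suc j) = 0
binomBelow (suc r) (suc n) (suc j) = binomBelow (suc r) n (suc j) + binomBelow r n j

binomBelow-suc : (r n : ℕ) → binomBelow (suc r) (suc n) ≗ binomBelow (suc r) n ⊕ shift (binomBelow r n)
binomBelow-suc r n zero = refl
binomBelow-suc r n (suc j) = refl

binomBelow-≥ : (r n j : ℕ) → r ≤ j → binomBelow r n j ≡ 0
binomBelow-≥ zero n j _ = refl
binomBelow-≥ (suc r) zero (suc j) _ = refl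
binomBelow-≥ (suc r) (suc n) (suc j) (s≤s r≤j) =
  cong₂ _+_ (binomBelow-≥ (suc r) n (suc j) (s≤s r≤j)) (binomBelow-≥ r n j r≤j)

binomBelow-1 : (r n : ℕ) → binomBelow (2 + r) n 1 ≡ n
binomBelow-1 r zero = refl
binomBelow-1 r (suc n) = trans (cong (_+ 1) (binomBelow-1 r n)) (+-comm n 1)

⊕-shift-binomBelow-≥ : (r n j : ℕ) (q : ℕ → ℕ) → r ≤ j → (q ⊕ shift (binomBelow r n)) (suc j) ≡ q (suc j)
⊕-shift-binomBelow-≥ r n j q r≤j = trans (cong (q (suc j) +_) (binomBelow-≥ r n j r≤j)) (+-identityʳ _)

admissibleCount-∷ʳ-false : (r : ℕ) {n : ℕ} (v : Vec Bool n) →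
                           admissibleCount r (v ∷ʳ false) ≗ admissibleCount r v ⊕ shift (admissibleCount r v)
admissibleCount-∷ʳ-false r [] zero = refl
admissibleCount-∷ʳ-false zero [] (suc j) = refl
admissibleCount-∷ʳ-false (suc r) [] (suc zero) = refl
admissibleCount-∷ʳ-false (suc r) [] (suc (suc j)) = refl
admissibleCount-∷ʳ-false r (x ∷ v) zero = admissibleCount-∷ʳ-false r v zero
admissibleCount-∷ʳ-false r (x ∷ v) (suc j) = begin
  admissibleCount r (v ∷ʳ false) (suc j) + admissibleWithHead r x (v ∷ʳ false) j
    ≡⟨ cong₂ _+_ (admissibleCount-∷ʳ-false r v (suc j)) (withHead r x j) ⟩
  (admissibleCount r v (suc j) + admissibleCount r v j) + (admissibleWithHead r x v j + shift (admissibleWithHead r x v) j)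
    ≡⟨ +-interchange (admissibleCount r v (suc j)) _ (admissibleWithHead r x v j) _ ⟩
  admissibleCount r (x ∷ v) (suc j) + (admissibleCount r v ⊕ shift (admissibleWithHead r x v)) j
    ≡⟨ cong (admissibleCount r (x ∷ v) (suc j) +_) (sym (admissibleCount-∷ r x v j)) ⟩
  admissibleCount r (x ∷ v) (suc j) + admissibleCount r (x ∷ v) j ∎
  where
  open ≡-Reasoning
  withHead : (r : ℕ) (x : Bool) →
             admissibleWithHead r x (v ∷ʳ false) ≗ admissibleWithHead r x v ⊕ shift (admissibleWithHead r x v)
  withHead (suc r) x = admissibleCount-∷ʳ-false r v
  withHead zero false = admissibleCount-∷ʳ-false zero v
  withHead zero true j = sym (shift-zero j)

admissibleCount₀-∷ʳ-true : {n : ℕ} (v : Vec Bool n) → admissibleCount zero (v ∷ʳ true) ≗ admissibleCount zero v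
admissibleCount₀-∷ʳ-true v zero = trans (admissibleCount-0 zero (v ∷ʳ true)) (sym (admissibleCount-0 zero v))
admissibleCount₀-∷ʳ-true [] (suc j) = refl
admissibleCount₀-∷ʳ-true (true ∷ v) (suc j) = cong (_+ 0) (admissibleCount₀-∷ʳ-true v (suc j))
admissibleCount₀-∷ʳ-true (false ∷ v) (suc j) =
  cong₂ _+_ (admissibleCount₀-∷ʳ-true v (suc j)) (admissibleCount₀-∷ʳ-true v j)

admissibleCount-∷ʳ-true : (r : ℕ) {n : ℕ} (v : Vec Bool n) →
                          admissibleCount r (v ∷ʳ true) ≗ admissibleCount r v ⊕ shift (binomBelow r n)
admissibleCount-∷ʳ-true zero v j =
  trans (admissibleCount₀-∷ʳ-true v j) (sym (trans (cong (admissibleCount zero v j +_) (shift-zero j)) (+-identityʳ _)))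
admissibleCount-∷ʳ-true (suc r) [] zero = refl
admissibleCount-∷ʳ-true (suc r) [] (suc zero) = refl
admissibleCount-∷ʳ-true (suc r) [] (suc (suc j)) = refl
admissibleCount-∷ʳ-true (suc r) (x ∷ v) zero = admissibleCount-∷ʳ-true (suc r) v zero
admissibleCount-∷ʳ-true (suc r) {suc n} (x ∷ v) (suc j) = begin
  admissibleCount (suc r) (v ∷ʳ true) (suc j) + admissibleCount r (v ∷ʳ true) j
    ≡⟨ cong₂ _+_ (admissibleCount-∷ʳ-true (suc r) v (suc j)) (admissibleCount-∷ʳ-true r v j) ⟩
  (admissibleCount (suc r) v (suc j) + binomBelow (suc r) n j) + (admissibleCount r v j + shift (binomBelow r n) j)
    ≡⟨ +-interchange (admissibleCount (suc r) v (suc j)) _ (admissibleCount r v j) _ ⟩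
  admissibleCount (suc r) (x ∷ v) (suc j) + (binomBelow (suc r) n ⊕ shift (binomBelow r n)) j
    ≡⟨ cong (admissibleCount (suc r) (x ∷ v) (suc j) +_) (sym (binomBelow-suc r n j)) ⟩
  admissibleCount (suc r) (x ∷ v) (suc j) + binomBelow (suc r) (suc n) j ∎
  where open ≡-Reasoning

alternating : Bool → (m : ℕ) → Vec Bool m
alternating l zero = []
alternating l (suc m) = (if even? m then l else not l) ∷ alternating l m

alternating-suc : (l : Bool) (m : ℕ) → alternating l (suc m) ≡ alternating (not l) m ∷ʳ l
alternating-suc l zero = refl
alternating-suc l (suc m) = cong₂ _∷_ (swapBranches l (even? m)) (alternating-suc l m)
  where
  swapBranches : (l e : Bool) → (if not e then l else not l) ≡ (if e then not l else not (not l))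
  swapBranches true true = refl
  swapBranches true false = refl
  swapBranches false true = refl
  swapBranches false false = refl

antiString : Bool → (n : ℕ) → Vec Bool n
antiString l n = tabulate (antiBits l n)

antiString-2+ : (l : Bool) (m : ℕ) → antiString l (2 + m) ≡ false ∷ false ∷ alternating l m
antiString-2+ l m = cong (λ v → false ∷ false ∷ v) (tabulated m)
  where
  tabulated : (m : ℕ) → tabulate (λ i → if even? (m ∸ suc (toℕ i)) then l else not l) ≡ alternating l m
  tabulated zero = refl
  tabulated (suc m) = cong ((if even? m then l else not l) ∷_) (tabulated m)

antiString-3+ : (l : Bool) (m : ℕ) → antiString l (3 + m) ≡ antiString (not l) (2 + m) ∷ʳ l
antiString-3+ l m = begin
  antiString l (3 + m)                        ≡⟨ antiString-2+ l (suc m) ⟩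
  false ∷ false ∷ alternating l (suc m)       ≡⟨ cong (λ v → false ∷ false ∷ v) (alternating-suc l m) ⟩
  false ∷ false ∷ (alternating (not l) m ∷ʳ l) ≡⟨ cong (_∷ʳ l) (sym (antiString-2+ (not l) m)) ⟩
  antiString (not l) (2 + m) ∷ʳ l             ∎
  where open ≡-Reasoning

coeffA coeffĀ : ℕ → ℕ → ℕ
coeffA n = admissibleCount 2 (antiString true n)
coeffĀ n = admissibleCount 2 (antiString false n)

coeffĀ-3+ : (m : ℕ) → coeffĀ (3 + m) ≗ coeffA (2 + m) ⊕ shift (coeffA (2 + m))
coeffĀ-3+ m j =
  trans (cong (λ v → admissibleCount 2 v j) (antiString-3+ false m)) (admissibleCount-∷ʳ-false 2 (antiString true (2 + m)) j)

coeffA-3+ : (m : ℕ) → coeffA (3 + m) ≗ coeffĀ (2 + m) ⊕ shift (binomBelow 2 (2 + m))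
coeffA-3+ m j =
  trans (cong (λ v → admissibleCount 2 v j) (antiString-3+ true m)) (admissibleCount-∷ʳ-true 2 (antiString false (2 + m)) j)

coeffA-3+-high : (m j : ℕ) → coeffA (3 + m) (3 + j) ≡ coeffĀ (2 + m) (3 + j)
coeffA-3+-high m j =
  trans (coeffA-3+ m (3 + j)) (⊕-shift-binomBelow-≥ 2 (2 + m) (2 + j) (coeffĀ (2 + m)) (m≤m+n 2 j))

coeffĀ-4+-3 : (m : ℕ) → coeffĀ (4 + m) 3 ≡ coeffĀ (2 + m) 3 + choose2 (3 + m)
coeffĀ-4+-3 m =
  trans (coeffĀ-3+ (suc m) 3) (cong₂ _+_ (coeffA-3+-high m 0) (admissibleCount-2 0 (antiString true (3 + m))))

coeffĀ-4+-4 : (m : ℕ) → coeffĀ (4 + m) 4 ≡ coeffĀ (2 + m) 4 + coeffĀ (2 + m) 3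
coeffĀ-4+-4 m = trans (coeffĀ-3+ (suc m) 4) (cong₂ _+_ (coeffA-3+-high m 1) (coeffA-3+-high m 0))

LogConcaveSeq : (ℕ → ℕ) → Set
LogConcaveSeq f = ∀ m → f m * f (2 + m) ≤ f (1 + m) * f (1 + m)

ZerosPersist : (ℕ → ℕ) → Set
ZerosPersist f = ∀ i → f i ≡ 0 → f (suc i) ≡ 0

GaplessLogConcave : (ℕ → ℕ) → Set
GaplessLogConcave f = LogConcaveSeq f × ZerosPersist f

gaplessLogConcave-resp : {f g : ℕ → ℕ} → f ≗ g → GaplessLogConcave f → GaplessLogConcave g
gaplessLogConcave-resp {f} {g} f≗g (lc , zp) = lcg , zpg
  where
  lcg : LogConcaveSeq g
  lcg m = subst₂ _≤_ (cong₂ _*_ (f≗g m) (f≗g (2 + m))) (cong₂ _*_ (f≗g (1 + m)) (f≗g (1 + m))) (lc m)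
  zpg : ZerosPersist g
  zpg i gi≡0 = trans (sym (f≗g (suc i))) (zp i (trans (f≗g i) gi≡0))

*-cross-≤ : (a b c d : ℕ) → a * c ≤ b * b → b * d ≤ c * c → (b ≡ 0 → d ≡ 0) → (c ≡ 0 → d ≡ 0) → a * d ≤ b * c
*-cross-≤ a zero c d _ _ b≡0 _ rewrite b≡0 refl | *-zeroʳ a = z≤n
*-cross-≤ a (suc b) zero d _ _ _ c≡0 rewrite c≡0 refl | *-zeroʳ a = z≤n
*-cross-≤ a b@(suc _) c@(suc _) d ac≤bb bd≤cc _ _ =
  *-cancelʳ-≤ (a * d) (b * c) (b * c) (subst₂ _≤_ (reorder a b c d) (squares b c) (*-mono-≤ ac≤bb bd≤cc))
  where
  reorder : (a b c d : ℕ) → (a * c) * (b * d) ≡ (a * d) * (b * c)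
  reorder = solve-∀
  squares : (b c : ℕ) → (b * b) * (c * c) ≡ (b * c) * (b * c)
  squares = solve-∀

logConcave-skip : {f : ℕ → ℕ} → GaplessLogConcave f → ∀ m → f m * f (3 + m) ≤ f (1 + m) * f (2 + m)
logConcave-skip {f} (lc , zp) m =
  *-cross-≤ (f m) (f (1 + m)) (f (2 + m)) (f (3 + m)) (lc m) (lc (suc m)) (zp (2 + m) ∘ zp (suc m)) (zp (2 + m))

gaplessLogConcave-1+X : {f : ℕ → ℕ} → GaplessLogConcave f → GaplessLogConcave (f ⊕ shift f)
gaplessLogConcave-1+X {f} glc@(lc , zp) = lcg , zpg
  where
  lcg : LogConcaveSeq (f ⊕ shift f)
  lcg zero rewrite +-identityʳ (f 0) = begin
    f 0 * (f 2 + f 1)                  ≡⟨ *-distribˡ-+ (f 0) (f 2) (f 1) ⟩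
    f 0 * f 2 + f 0 * f 1              ≤⟨ +-monoˡ-≤ (f 0 * f 1) (lc 0) ⟩
    f 1 * f 1 + f 0 * f 1              ≤⟨ m≤m+n _ (f 0 * f 1 + f 0 * f 0) ⟩
    f 1 * f 1 + f 0 * f 1 + (f 0 * f 1 + f 0 * f 0) ≡⟨ square (f 0) (f 1) ⟩
    (f 1 + f 0) * (f 1 + f 0)          ∎
    where
    open ≤-Reasoning
    square : (a b : ℕ) → b * b + a * b + (a * b + a * a) ≡ (b + a) * (b + a)
    square = solve-∀
  lcg (suc m) = begin
    (f1 + f0) * (f3 + f2)               ≡⟨ expand f0 f1 f2 f3 ⟩
    f1 * f3 + (f1 * f2 + (f0 * f3 + f0 * f2))
      ≤⟨ +-mono-≤ (lc (suc m)) (+-monoʳ-≤ (f1 * f2) (+-mono-≤ (logConcave-skip glc m) (lc m))) ⟩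
    f2 * f2 + (f1 * f2 + (f1 * f2 + f1 * f1)) ≡⟨ square f1 f2 ⟩
    (f2 + f1) * (f2 + f1)               ∎
    where
    open ≤-Reasoning
    f0 f1 f2 f3 : ℕ
    f0 = f m
    f1 = f (1 + m)
    f2 = f (2 + m)
    f3 = f (3 + m)
    expand : (a b c d : ℕ) → (b + a) * (d + c) ≡ b * d + (b * c + (a * d + a * c))
    expand = solve-∀
    square : (b c : ℕ) → c * c + (b * c + (b * c + b * b)) ≡ (c + b) * (c + b)
    square = solve-∀
  zpg : ZerosPersist (f ⊕ shift f)
  zpg zero h = let f0≡0 = trans (sym (+-identityʳ (f 0))) h in cong₂ _+_ (zp 0 f0≡0) f0≡0
  zpg (suc i) h = cong₂ _+_ (zp (suc i) (m+n≡0⇒m≡0 (f (suc i)) h)) (zp i (m+n≡0⇒n≡0 (f (suc i)) h))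

-- The sum has coefficients 1, n + 1, C(n+1, 2), q₃, q₄, …, so beyond those of q only the
-- inequalities at X, X² and X³ are new, and the first of them is automatic.
gaplessLogConcave-+X+nX² : (n : ℕ) {{_ : NonZero n}} {q : ℕ → ℕ} → GaplessLogConcave q →
  q 0 ≡ 1 → q 1 ≡ n → q 2 ≡ choose2 n →
  suc n * q 3 ≤ choose2 (suc n) * choose2 (suc n) → choose2 (suc n) * q 4 ≤ q 3 * q 3 →
  GaplessLogConcave (q ⊕ shift (binomBelow 2 n))
gaplessLogConcave-+X+nX² n@(suc k) {q} (lc , zp) q0 q1 q2 boundX³ boundX⁴ = lcp , zpp
  where
  p : ℕ → ℕ
  p = q ⊕ shift (binomBelow 2 n)
  p0 : p 0 ≡ 1
  p0 = trans (+-identityʳ (q 0)) q0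
  p1 : p 1 ≡ suc n
  p1 = trans (cong (_+ 1) q1) (+-comm n 1)
  p2 : p 2 ≡ choose2 (suc n)
  p2 = cong₂ _+_ q2 (binomBelow-1 0 n)
  p3+ : (j : ℕ) → p (3 + j) ≡ q (3 + j)
  p3+ j = ⊕-shift-binomBelow-≥ 2 n (2 + j) q (m≤m+n 2 j)
  lcp : LogConcaveSeq p
  lcp 0 = subst₂ _≤_ (sym (cong₂ _*_ p0 p2)) (sym (cong₂ _*_ p1 p1))
                     (subst (_≤ suc n * suc n) (sym (*-identityˡ _)) (choose2≤square (suc n)))
  lcp 1 = subst₂ _≤_ (sym (cong₂ _*_ p1 (p3+ 0))) (sym (cong₂ _*_ p2 p2)) boundX³
  lcp 2 = subst₂ _≤_ (sym (cong₂ _*_ p2 (p3+ 1))) (sym (cong₂ _*_ (p3+ 0) (p3+ 0))) boundX⁴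
  lcp (suc (suc (suc m))) =
    subst₂ _≤_ (sym (cong₂ _*_ (p3+ m) (p3+ (2 + m)))) (sym (cong₂ _*_ (p3+ (1 + m)) (p3+ (1 + m)))) (lc (3 + m))
  zpp : ZerosPersist p
  zpp 0 h with () ← trans (sym p0) h
  zpp 1 h with () ← trans (sym p1) h
  zpp 2 h with () ← trans (sym (trans p2 (+-suc (choose2 n) k))) h
  zpp (suc (suc (suc j))) h = trans (p3+ (suc j)) (zp (3 + j) (trans (sym (p3+ j)) h))

scaledTelescope : (k : ℕ) (f g P G : ℕ → ℕ) → (∀ a → f (suc a) ≡ f a + g a) → (∀ a → k * g a ≡ G a) →
                  (∀ a → P a + G a ≡ P (suc a)) → k * f 0 ≡ P 0 → ∀ a → k * f a ≡ P a
scaledTelescope k f g P G step kg≡G PG≡P base zero = base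
scaledTelescope k f g P G step kg≡G PG≡P base (suc a) = begin
  k * f (suc a)       ≡⟨ cong (k *_) (step a) ⟩
  k * (f a + g a)     ≡⟨ *-distribˡ-+ k (f a) (g a) ⟩
  k * f a + k * g a   ≡⟨ cong₂ _+_ (scaledTelescope k f g P G step kg≡G PG≡P base a) (kg≡G a) ⟩
  P a + G a           ≡⟨ PG≡P a ⟩
  P (suc a)           ∎
  where open ≡-Reasoning

twice-choose2 : (n : ℕ) → 2 * choose2 (suc n) ≡ suc n * n
twice-choose2 zero = refl
twice-choose2 (suc n) =
  trans (*-distribˡ-+ 2 (choose2 (suc n)) (suc n)) (trans (cong (_+ 2 * suc n) (twice-choose2 n)) (expand n))
  where
  expand : (n : ℕ) → suc n * n + 2 * suc n ≡ suc (suc n) * suc n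
  expand = solve-∀

six-choose2 : (n : ℕ) → 6 * choose2 (suc n) ≡ 3 * (suc n * n)
six-choose2 n = trans (*-assoc 3 2 (choose2 (suc n))) (cong (3 *_) (twice-choose2 n))

-- The two-step recurrences telescope to closed forms depending on the parity of n.
coeffĀ-even-3 : (a : ℕ) → 6 * coeffĀ (2 + a * 2) 3 ≡ (a + 1) * a * (4 * a + 5)
coeffĀ-even-3 = scaledTelescope 6 (λ a → coeffĀ (2 + a * 2) 3) (λ a → choose2 (3 + a * 2))
  (λ a → (a + 1) * a * (4 * a + 5)) (λ a → 3 * ((3 + a * 2) * (2 + a * 2)))
  (λ a → coeffĀ-4+-3 (a * 2)) (λ a → six-choose2 (2 + a * 2)) poly refl
  where
  poly : (a : ℕ) → (a + 1) * a * (4 * a + 5) + 3 * ((3 + a * 2) * (2 + a * 2)) ≡ (suc a + 1) * suc a * (4 * suc a + 5)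
  poly = solve-∀

coeffĀ-even-4 : (b : ℕ) → 6 * coeffĀ (4 + b * 2) 4 ≡ (b + 2) * (b + 2) * (b + 1) * b
coeffĀ-even-4 = scaledTelescope 6 (λ b → coeffĀ (4 + b * 2) 4) (λ b → coeffĀ (4 + b * 2) 3)
  (λ b → (b + 2) * (b + 2) * (b + 1) * b) (λ b → (suc b + 1) * suc b * (4 * suc b + 5))
  (λ b → coeffĀ-4+-4 (2 + b * 2)) (λ b → coeffĀ-even-3 (suc b)) poly refl
  where
  poly : (b : ℕ) → (b + 2) * (b + 2) * (b + 1) * b + (suc b + 1) * suc b * (4 * suc b + 5)
                 ≡ (suc b + 2) * (suc b + 2) * (suc b + 1) * suc b
  poly = solve-∀

coeffĀ-odd-3 : (a : ℕ) → 6 * coeffĀ (3 + a * 2) 3 ≡ (a + 1) * (a + 2) * (4 * a + 3)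
coeffĀ-odd-3 = scaledTelescope 6 (λ a → coeffĀ (3 + a * 2) 3) (λ a → choose2 (4 + a * 2))
  (λ a → (a + 1) * (a + 2) * (4 * a + 3)) (λ a → 3 * ((4 + a * 2) * (3 + a * 2)))
  (λ a → coeffĀ-4+-3 (1 + a * 2)) (λ a → six-choose2 (3 + a * 2)) poly refl
  where
  poly : (a : ℕ) → (a + 1) * (a + 2) * (4 * a + 3) + 3 * ((4 + a * 2) * (3 + a * 2)) ≡ (suc a + 1) * (suc a + 2) * (4 * suc a + 3)
  poly = solve-∀

coeffĀ-odd-4 : (a : ℕ) → 6 * coeffĀ (3 + a * 2) 4 ≡ (a + 1) * a * a * (a + 2)
coeffĀ-odd-4 = scaledTelescope 6 (λ a → coeffĀ (3 + a * 2) 4) (λ a → coeffĀ (3 + a * 2) 3)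
  (λ a → (a + 1) * a * a * (a + 2)) (λ a → (a + 1) * (a + 2) * (4 * a + 3))
  (λ a → coeffĀ-4+-4 (1 + a * 2)) coeffĀ-odd-3 poly refl
  where
  poly : (a : ℕ) → (a + 1) * a * a * (a + 2) + (a + 1) * (a + 2) * (4 * a + 3) ≡ (suc a + 1) * suc a * suc a * (suc a + 2)
  poly = solve-∀

≤-from-gap : (k : ℕ) {{_ : NonZero k}} {x y : ℕ} (d : ℕ) → k * x + d ≡ k * y → x ≤ y
≤-from-gap k {x} d eq = *-cancelˡ-≤ k (subst (k * x ≤_) eq (m≤m+n (k * x) d))

boundX³-from : (n q P d : ℕ) → 6 * q ≡ P → 2 * (3 + n) * P + d ≡ 3 * ((3 + n) * (2 + n)) * ((3 + n) * (2 + n)) →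
               (3 + n) * q ≤ choose2 (3 + n) * choose2 (3 + n)
boundX³-from n q P d 6q≡P identity = ≤-from-gap 12 d (begin
  12 * ((3 + n) * q) + d                         ≡⟨ cong (_+ d) (regroup (3 + n) q) ⟩
  2 * (3 + n) * (6 * q) + d                      ≡⟨ cong (λ t → 2 * (3 + n) * t + d) 6q≡P ⟩
  2 * (3 + n) * P + d                            ≡⟨ identity ⟩
  3 * ((3 + n) * (2 + n)) * ((3 + n) * (2 + n))  ≡⟨ cong (λ t → 3 * t * t) (twice-choose2 (2 + n)) ⟨
  3 * (2 * c) * (2 * c)                          ≡⟨ square c ⟨
  12 * (c * c)                                   ∎)
  where
  open ≡-Reasoning
  c : ℕ
  c = choose2 (3 + n)
  regroup : (u q : ℕ) → 12 * (u * q) ≡ 2 * u * (6 * q)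
  regroup = solve-∀
  square : (c : ℕ) → 12 * (c * c) ≡ 3 * (2 * c) * (2 * c)
  square = solve-∀

boundX⁴-from : (n q₃ q₄ P₃ P₄ d : ℕ) → 6 * q₃ ≡ P₃ → 6 * q₄ ≡ P₄ → 3 * ((3 + n) * (2 + n)) * P₄ + d ≡ P₃ * P₃ →
               choose2 (3 + n) * q₄ ≤ q₃ * q₃
boundX⁴-from n q₃ q₄ P₃ P₄ d 6q₃≡P₃ 6q₄≡P₄ identity = ≤-from-gap 36 d (begin
  36 * (c * q₄) + d                        ≡⟨ cong (_+ d) (regroup c q₄) ⟩
  3 * (2 * c) * (6 * q₄) + d               ≡⟨ cong₂ (λ s t → 3 * s * t + d) (twice-choose2 (2 + n)) 6q₄≡P₄ ⟩
  3 * ((3 + n) * (2 + n)) * P₄ + d         ≡⟨ identity ⟩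
  P₃ * P₃                                  ≡⟨ cong₂ _*_ 6q₃≡P₃ 6q₃≡P₃ ⟨
  (6 * q₃) * (6 * q₃)                      ≡⟨ square q₃ ⟨
  36 * (q₃ * q₃)                           ∎)
  where
  open ≡-Reasoning
  c : ℕ
  c = choose2 (3 + n)
  regroup : (c q : ℕ) → 36 * (c * q) ≡ 3 * (2 * c) * (6 * q)
  regroup = solve-∀
  square : (q : ℕ) → 36 * (q * q) ≡ (6 * q) * (6 * q)
  square = solve-∀

LowCoefficientBounds : ℕ → Set
LowCoefficientBounds m =
  ((3 + m) * coeffĀ (2 + m) 3 ≤ choose2 (3 + m) * choose2 (3 + m)) ×
  (choose2 (3 + m) * coeffĀ (2 + m) 4 ≤ coeffĀ (2 + m) 3 * coeffĀ (2 + m) 3)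

-- The gaps below are the differences of the two sides, written with nonnegative coefficients.
lowCoefficientBounds-even : (a : ℕ) → LowCoefficientBounds (a * 2)
lowCoefficientBounds-even a = boundX³ a , boundX⁴ a
  where
  boundX³ : (a : ℕ) → (3 + a * 2) * coeffĀ (2 + a * 2) 3 ≤ choose2 (3 + a * 2) * choose2 (3 + a * 2)
  boundX³ a = boundX³-from (a * 2) (coeffĀ (2 + a * 2) 3) _ ((2 * a + 3) * (a + 1) * (16 * a * a + 50 * a + 36))
                (coeffĀ-even-3 a) (poly a)
    where
    poly : (a : ℕ) → 2 * (3 + a * 2) * ((a + 1) * a * (4 * a + 5)) + (2 * a + 3) * (a + 1) * (16 * a * a + 50 * a + 36)
                   ≡ 3 * ((3 + a * 2) * (2 + a * 2)) * ((3 + a * 2) * (2 + a * 2))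
    poly = solve-∀
  boundX⁴ : (a : ℕ) → choose2 (3 + a * 2) * coeffĀ (2 + a * 2) 4 ≤ coeffĀ (2 + a * 2) 3 * coeffĀ (2 + a * 2) 3
  boundX⁴ zero = z≤n
  boundX⁴ (suc b) =
    boundX⁴-from (suc b * 2) (coeffĀ (4 + b * 2) 3) (coeffĀ (4 + b * 2) 4) _ _
      ((b + 2) * (b + 2) * (b + 1) * (4 * b * b * b + 34 * b * b + 93 * b + 81))
      (coeffĀ-even-3 (suc b)) (coeffĀ-even-4 b) (poly b)
    where
    poly : (b : ℕ) → 3 * ((3 + suc b * 2) * (2 + suc b * 2)) * ((b + 2) * (b + 2) * (b + 1) * b)
                     + (b + 2) * (b + 2) * (b + 1) * (4 * b * b * b + 34 * b * b + 93 * b + 81)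
                   ≡ ((suc b + 1) * suc b * (4 * suc b + 5)) * ((suc b + 1) * suc b * (4 * suc b + 5))
    poly = solve-∀

lowCoefficientBounds-odd : (a : ℕ) → LowCoefficientBounds (1 + a * 2)
lowCoefficientBounds-odd a =
  boundX³-from (1 + a * 2) (coeffĀ (3 + a * 2) 3) _ (4 * (a + 2) * (a + 2) * (8 * a * a + 29 * a + 24))
    (coeffĀ-odd-3 a) (polyX³ a) ,
  boundX⁴-from (1 + a * 2) (coeffĀ (3 + a * 2) 3) (coeffĀ (3 + a * 2) 4) _ _
    ((a + 1) * (a + 2) * (a + 2) * (4 * a * a * a + 22 * a * a + 33 * a + 9))
    (coeffĀ-odd-3 a) (coeffĀ-odd-4 a) (polyX⁴ a)
  where
  polyX³ : (a : ℕ) → 2 * (4 + a * 2) * ((a + 1) * (a + 2) * (4 * a + 3)) + 4 * (a + 2) * (a + 2) * (8 * a * a + 29 * a + 24)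
                   ≡ 3 * ((4 + a * 2) * (3 + a * 2)) * ((4 + a * 2) * (3 + a * 2))
  polyX³ = solve-∀
  polyX⁴ : (a : ℕ) → 3 * ((4 + a * 2) * (3 + a * 2)) * ((a + 1) * a * a * (a + 2))
                     + (a + 1) * (a + 2) * (a + 2) * (4 * a * a * a + 22 * a * a + 33 * a + 9)
                   ≡ ((a + 1) * (a + 2) * (4 * a + 3)) * ((a + 1) * (a + 2) * (4 * a + 3))
  polyX⁴ = solve-∀

parity : (m : ℕ) → Σ ℕ (λ a → m ≡ a * 2) ⊎ Σ ℕ (λ a → m ≡ 1 + a * 2)
parity zero = inj₁ (0 , refl)
parity (suc m) with parity m
... | inj₁ (a , m≡2a)   = inj₂ (a , cong suc m≡2a)
... | inj₂ (a , m≡2a+1) = inj₁ (suc a , cong suc m≡2a+1)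

lowCoefficientBounds : (m : ℕ) → LowCoefficientBounds m
lowCoefficientBounds m with parity m
... | inj₁ (a , m≡2a)   = subst LowCoefficientBounds (sym m≡2a) (lowCoefficientBounds-even a)
... | inj₂ (a , m≡2a+1) = subst LowCoefficientBounds (sym m≡2a+1) (lowCoefficientBounds-odd a)

gaplessLogConcave-[] : (r : ℕ) → GaplessLogConcave (admissibleCount r [])
gaplessLogConcave-[] r = lc , zp
  where
  lc : LogConcaveSeq (admissibleCount r [])
  lc zero = z≤n
  lc (suc m) = z≤n
  zp : ZerosPersist (admissibleCount r [])
  zp (suc i) _ = refl

gaplessLogConcave-∷ʳ-false : (r : ℕ) {n : ℕ} (v : Vec Bool n) →
  GaplessLogConcave (admissibleCount r v) → GaplessLogConcave (admissibleCount r (v ∷ʳ false))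
gaplessLogConcave-∷ʳ-false r v glc =
  gaplessLogConcave-resp (sym ∘ admissibleCount-∷ʳ-false r v) (gaplessLogConcave-1+X glc)

gaplessLogConcave-antiregular : (n : ℕ) → GaplessLogConcave (coeffA n) × GaplessLogConcave (coeffĀ n)
gaplessLogConcave-antiregular 0 = gaplessLogConcave-[] 2 , gaplessLogConcave-[] 2
gaplessLogConcave-antiregular 1 =
  gaplessLogConcave-∷ʳ-false 2 [] (gaplessLogConcave-[] 2) , gaplessLogConcave-∷ʳ-false 2 [] (gaplessLogConcave-[] 2)
gaplessLogConcave-antiregular 2 =
  let (glcA , glcĀ) = gaplessLogConcave-antiregular 1
  in gaplessLogConcave-∷ʳ-false 2 (antiString true 1) glcA , gaplessLogConcave-∷ʳ-false 2 (antiString false 1) glcĀ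
gaplessLogConcave-antiregular (suc (suc (suc m))) =
  let (glcA , glcĀ) = gaplessLogConcave-antiregular (suc (suc m))
      v = antiString false (2 + m)
      (boundX³ , boundX⁴) = lowCoefficientBounds m
  in gaplessLogConcave-resp (sym ∘ coeffA-3+ m)
       (gaplessLogConcave-+X+nX² (2 + m) glcĀ (admissibleCount-0 2 v) (admissibleCount-1 1 v) (admissibleCount-2 0 v)
                                 boundX³ boundX⁴)
   , gaplessLogConcave-resp (sym ∘ coeffĀ-3+ m) (gaplessLogConcave-1+X glcA)

-- The inequalities hold at every index, so the degree bound of LogConcave is not needed.
indepLogConcave-from : {n : ℕ} (G : Hypergraph3 n) (f : ℕ → ℕ) → indepCoeff G ≗ f → LogConcaveSeq f → IndepLogConcave G
indepLogConcave-from G f coeff≗f lc (suc i) _ _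
  rewrite coeff≗f i | coeff≗f (suc i + 1) | coeff≗f (suc i) | +-comm i 1 = lc i

theorem3p2 : (n : ℕ) → n ≥ 1 → IndepLogConcave (A n) × IndepLogConcave (Ā n)
theorem3p2 n _ =
  let (glcA , glcĀ) = gaplessLogConcave-antiregular n
  in indepLogConcave-from (A n) (coeffA n) (indepCoeff-H (antiBits true n)) (proj₁ glcA)
   , indepLogConcave-from (Ā n) (coeffĀ n) (indepCoeff-H (antiBits false n)) (proj₁ glcĀ)
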